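{- For every finite simple graph $G$ and every pair of distinct vertices $a,b$ of $G$, the skew characteristic polynomial satisfies $$Q_G(u)-Q_{G'_{ab}}(u)=Q_{\widetilde{G}_{ab}}(u)-Q_{\widetilde{G}'_{ab}}(u).$$
   Context: For a simple graph $G$, $A(G)$ denotes its adjacency matrix over $\mathbb{F}_2$ (entry $1$ iff the vertices are adjacent, zero diagonal); the nondegeneracy $\nu(G)$ is $1$ if $A(G)$ is invertible over $\mathbb{F}_2$ and $0$ otherwise (the empty graph counts as nondegenerate). The skew characteristic polynomial is $Q_G(u)=\sum_{U\subset V(G)}\nu(G|_U)\,u^{|V(G)|-|U|}$, where $G|_U$ is the subgraph induced on $U$. For vertices $a\ne b$: $G'_{ab}$ is obtained from $G$ by switching the adjacency between $a$ and $b$; $\widetilde{G}_{ab}$ is obtained from $G$ by switching the adjacency of $a$ with every vertex $v\neq a$ adjacent to $b$; $\widetilde{G}'_{ab}$ is the result of applying both operations (they commute). -}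

module Defs where

open import Data.Nat using (ℕ; zero; suc; _∸_)
open import Data.Bool using (Bool; true; false; _∧_; _∨_; _xor_; not; if_then_else_)
open import Data.Fin using (Fin; zero; suc; punchIn; _≟_)
open import Data.Fin.Subset using (Subset; ∣_∣)
open import Data.List using (List; []; _∷_; length; map; foldr; allFin; _++_; filter; lookup)
open import Data.Vec using (Vec; []; _∷_)
open import Data.Integer using (ℤ; +_)
open import Relation.Binary.PropositionalEquality using (_≡_)
open import Relation.Nullary.Decidable using (⌊_⌋)
open import Data.Product using (_×_)

-- A matrix over F₂ = Bool (xor is addition, ∧ is multiplication),
-- indexed by Fin m × Fin m.
Mat₂ : ℕ → Set
Mat₂ m = Fin m → Fin m → Bool

-- Determinant over F₂ by Laplace (cofactor) expansion along the first row;
-- signs are irrelevant in characteristic 2.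
det₂ : (m : ℕ) → Mat₂ m → Bool
det₂ zero    M = true
det₂ (suc m) M =
  foldr _xor_ false
    (map (λ j → M zero j ∧ det₂ m (λ r c → M (suc r) (punchIn j c))) (allFin (suc m)))

record SimpleGraph (n : ℕ) : Set where
  field
    adj   : Fin n → Fin n → Bool
    sym   : ∀ x y → adj x y ≡ adj y x
    irrefl : ∀ x → adj x x ≡ false
open SimpleGraph public

Adj : ℕ → Set
Adj n = Fin n → Fin n → Bool

allSubsets : (n : ℕ) → List (Subset n)
allSubsets zero    = [] ∷ []
allSubsets (suc n) = map (true ∷_) (allSubsets n) ++ map (false ∷_) (allSubsets n)

members : {n : ℕ} → Subset n → List (Fin n)
members []          = []
members (true  ∷ p) = zero ∷ map suc (members p)
members (false ∷ p) = map suc (members p)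

inducedMat : {n : ℕ} → Adj n → (U : Subset n) → Mat₂ (length (members U))
inducedMat A U i j = A (lookup (members U) i) (lookup (members U) j)

-- Nondegeneracy ν(G|_U): true iff A(G|_U) is invertible over F₂ (det ≠ 0);
-- the empty graph has det = 1, hence counts as nondegenerate.
ν : {n : ℕ} → Adj n → Subset n → Bool
ν A U = det₂ (length (members U)) (inducedMat A U)

-- Coefficient of u^k in Q_G(u) = Σ_{U ⊆ V} ν(G|_U) u^{|V|-|U|}:
-- the number of U with ν(G|_U) = 1 and |V| - |U| = k.
Qcoeff : {n : ℕ} → Adj n → ℕ → ℤ
Qcoeff {n} A k =
  + length (filter (λ U → Data.Bool._≟_ (ν A U ∧ ⌊ Data.Nat._≟_ (n ∸ ∣ U ∣) k ⌋) true)
                   (allSubsets n))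

_==_ : {n : ℕ} → Fin n → Fin n → Bool
x == y = ⌊ x ≟ y ⌋

-- G'_{ab}: switch the adjacency between a and b
switchEdge : {n : ℕ} → Fin n → Fin n → Adj n → Adj n
switchEdge a b A x y = A x y xor (((x == a) ∧ (y == b)) ∨ ((x == b) ∧ (y == a)))

-- G̃_{ab}: switch the adjacency of a with every vertex v ≠ a adjacent to b
switchNbhd : {n : ℕ} → Fin n → Fin n → Adj n → Adj n
switchNbhd a b A x y =
  A x y xor (((x == a) ∧ not (y == a) ∧ A b y) ∨ ((y == a) ∧ not (x == a) ∧ A b x))

-- For a vertex set U, let A_U be the adjacency matrix of G|_U. If a ∉ U or b ∉ U, switching the
-- edge ab changes neither G|_U nor G̃|_U. If a, b ∈ U, then A(G̃|_U) = E A_U Eᵀ, where E adds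
-- row b to row a: the correction at (a, a) is A_ab + A_ba + A_bb = 0 since G is symmetric and
-- loopless. Hence ν(G̃|_U) = ν(G|_U), and likewise ν(G̃'|_U) = ν(G'|_U) because switching the edge
-- ab commutes with switching the neighbourhood of a. In both cases the four values of ν satisfy
-- ν(G|_U) - ν(G'|_U) = ν(G̃|_U) - ν(G̃'|_U), and summing over U gives the identity coefficientwise.
--
-- The required facts about det₂ (invariance under transposition and under adding a row to another)
-- are derived from its definition by Laplace expansion along the first row. The main step is
-- expansion along an arbitrary row: expanding along two rows at once gives a sum over ordered pairs
-- of distinct columns, which can be enumerated from either row.

module Submission where

open import Algebra.Bundles using (CommutativeRing)
import Algebra.Properties.CommutativeSemigroup as CommutativeSemigroupProperties
open import Data.Bool using (Bool; true; false; _∧_; _∨_; _xor_; not; if_then_else_)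
open import Data.Bool.Properties
  using ( xor-∧-commutativeRing; xor-identityʳ; xor-same; xor-assoc; ∧-comm; ∧-zeroʳ; ∨-comm; ∨-identityʳ
        ; ∧-distribʳ-xor)
open import Data.Fin using (Fin; zero; suc; punchIn; _≟_)
open import Data.Fin.Properties using (punchInᵢ≢i; suc-injective)
open import Data.Fin.Subset using (Subset; _∈_; _∉_; ∣_∣)
open import Data.Fin.Subset.Properties using (_∈?_)
open import Data.Integer using (+_; _-_; _⊖_)
open import Data.Integer.Properties using ([+m]-[+n]≡m⊖n; +-cancelˡ-⊖)
open import Data.List using (List; []; _∷_; foldr; tabulate; lookup; length; filter)
open import Data.List.Membership.Propositional using () renaming (_∈_ to _∈ₗ_)
open import Data.List.Membership.Propositional.Properties using (∈-map⁺; ∈-map⁻; ∈-lookup)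
open import Data.List.Properties using (map-tabulate)
import Data.List.Relation.Unary.All as All
import Data.List.Relation.Unary.All.Properties as All
open import Data.List.Relation.Unary.AllPairs using ([]; _∷_)
open import Data.List.Relation.Unary.Any using (here; there; index)
open import Data.List.Relation.Unary.Any.Properties using (lookup-index)
open import Data.List.Relation.Unary.Unique.Propositional using (Unique)
open import Data.List.Relation.Unary.Unique.Propositional.Properties using (map⁺)
open import Data.Nat using (ℕ; zero; suc; _+_; _∸_)
open import Data.Nat.Properties using (+-comm; +-commutativeSemigroup)
open import Data.Product as Product using (∃-syntax; _×_; _,_)
open import Data.Sum as Sum using (_⊎_; inj₁; inj₂)
open import Data.Vec using ([]; _∷_; here; there)
open import Data.Vec.Functional using (updateAt)
open import Data.Vec.Functional.Properties using (updateAt-updates; updateAt-minimal)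
open import Defs hiding (sym)
open import Function using (_∘_; id)
open import Function.Definitions using (Injective)
open import Relation.Binary.PropositionalEquality
  using (_≡_; _≢_; refl; sym; trans; cong; cong₂; cong-app; module ≡-Reasoning)
open import Relation.Nullary using (yes; no; ¬_; contradiction)
open import Relation.Nullary.Decidable using (⌊_⌋)

open CommutativeRing xor-∧-commutativeRing using (semiring)
  renaming (+-commutativeSemigroup to xor-commutativeSemigroup; *-commutativeSemigroup to ∧-commutativeSemigroup)
open import Algebra.Properties.Semiring.Sum semiring
  using (sum; sum-syntax; sum-cong-≗; sum-remove; ∑-distrib-+; ∑-comm; *-distribˡ-sum; sum-replicate-zero)
open CommutativeSemigroupProperties xor-commutativeSemigroup using (xy∙z≈xz∙y)
open CommutativeSemigroupProperties ∧-commutativeSemigroup using (x∙yz≈y∙xz)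
open CommutativeSemigroupProperties +-commutativeSemigroup using (interchange)

private
  variable
    m n : ℕ

==-refl : (x : Fin n) → (x == x) ≡ true
==-refl x with x ≟ x
... | yes _   = refl
... | no x≢x = contradiction refl x≢x

==-≢ : {x y : Fin n} → x ≢ y → (x == y) ≡ false
==-≢ {x = x} {y} x≢y with x ≟ y
... | yes x≡y = contradiction x≡y x≢y
... | no _    = refl

==-sym : (x y : Fin n) → (x == y) ≡ (y == x)
==-sym x y with x ≟ y
... | yes refl = sym (==-refl x)
... | no x≢y   = sym (==-≢ (x≢y ∘ sym))

==-injective : {f : Fin m → Fin n} → Injective _≡_ _≡_ f → ∀ p i → (f p == f i) ≡ (p == i)
==-injective {f = f} inj p i with p ≟ i
... | yes refl = ==-refl (f p)
... | no p≢i   = ==-≢ (p≢i ∘ inj)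

∑-punchIn : (j : Fin (suc n)) (f : Fin (suc n) → Bool) →
            ∑[ l < n ] f (punchIn j l) ≡ ∑[ x < suc n ] (not (x == j) ∧ f x)
∑-punchIn j f = begin
  ∑[ l < _ ] f (punchIn j l)
    ≡⟨ sum-cong-≗ (λ l → cong (λ t → not t ∧ f (punchIn j l)) (==-≢ (punchInᵢ≢i j l))) ⟨
  ∑[ l < _ ] g (punchIn j l)
    ≡⟨ cong (λ t → (not t ∧ f j) xor ∑[ l < _ ] g (punchIn j l)) (==-refl j) ⟨
  g j xor ∑[ l < _ ] g (punchIn j l)
    ≡⟨ sum-remove {i = j} g ⟨
  ∑[ x < suc _ ] g x
    ∎
  where
  open ≡-Reasoning
  g : Fin (suc _) → Bool
  g x = not (x == j) ∧ f x

∑-pairs-flip : (F : Fin (suc n) → Fin (suc n) → Bool) →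
               ∑[ j < suc n ] ∑[ l < n ] F j (punchIn j l) ≡ ∑[ x < suc n ] ∑[ l < n ] F (punchIn x l) x
∑-pairs-flip F = begin
  ∑[ j < _ ] ∑[ l < _ ] F j (punchIn j l)
    ≡⟨ sum-cong-≗ (λ j → ∑-punchIn j (F j)) ⟩
  ∑[ j < _ ] ∑[ x < _ ] (not (x == j) ∧ F j x)
    ≡⟨ ∑-comm (λ j x → not (x == j) ∧ F j x) ⟩
  ∑[ x < _ ] ∑[ j < _ ] (not (x == j) ∧ F j x)
    ≡⟨ sum-cong-≗ (λ x → sum-cong-≗ (λ j → cong (λ t → not t ∧ F j x) (==-sym x j))) ⟩
  ∑[ x < _ ] ∑[ j < _ ] (not (j == x) ∧ F j x)
    ≡⟨ sum-cong-≗ (λ x → ∑-punchIn x (λ j → F j x)) ⟨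
  ∑[ x < _ ] ∑[ l < _ ] F (punchIn x l) x
    ∎
  where open ≡-Reasoning

∑∑-alternating : (S : Fin n → Fin n → Bool) → (∀ j → S j j ≡ false) → (∀ j x → S j x ≡ S x j) →
                 ∑[ j < n ] ∑[ x < n ] S j x ≡ false
∑∑-alternating {zero}  S diagonal symmetric = refl
∑∑-alternating {suc n} S diagonal symmetric = begin
  (S zero zero xor row₀) xor ∑[ j < n ] (S (suc j) zero xor ∑[ x < n ] S (suc j) (suc x))
    ≡⟨ cong₂ (λ s t → (s xor row₀) xor t) (diagonal zero) (∑-distrib-+ (λ j → S (suc j) zero) rest) ⟩
  row₀ xor (∑[ j < n ] S (suc j) zero xor ∑[ j < n ] rest j)
    ≡⟨ cong₂ (λ s t → row₀ xor (s xor t)) (sum-cong-≗ (λ j → symmetric (suc j) zero))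
             (∑∑-alternating (λ j x → S (suc j) (suc x)) (diagonal ∘ suc)
                             (λ j x → symmetric (suc j) (suc x))) ⟩
  row₀ xor (row₀ xor false)
    ≡⟨ cong (row₀ xor_) (xor-identityʳ row₀) ⟩
  row₀ xor row₀
    ≡⟨ xor-same row₀ ⟩
  false
    ∎
  where
  open ≡-Reasoning
  row₀ : Bool
  row₀ = ∑[ x < n ] S zero (suc x)
  rest : Fin n → Bool
  rest j = ∑[ x < n ] S (suc j) (suc x)

∑-pairs-symmetric : (F : Fin (suc n) → Fin (suc n) → Bool) → (∀ j x → F j x ≡ F x j) →
                    ∑[ j < suc n ] ∑[ l < n ] F j (punchIn j l) ≡ false
∑-pairs-symmetric F symmetric =
  trans (sum-cong-≗ (λ j → ∑-punchIn j (F j)))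
        (∑∑-alternating (λ j x → not (x == j) ∧ F j x)
          (λ j → cong (λ t → not t ∧ F j j) (==-refl j))
          (λ j x → cong₂ (λ s t → not s ∧ t) (==-sym x j) (symmetric j x)))

-- Enumerates Fin (2 + n) ∖ {j, x} in increasing order. The values for j ≡ x are junk, chosen so
-- that punchIn₂ is symmetric without a side condition.
punchIn₂ : Fin (suc (suc n)) → Fin (suc (suc n)) → Fin n → Fin (suc (suc n))
punchIn₂ zero    zero    c = suc (suc c)
punchIn₂ zero    (suc x) c = suc (punchIn x c)
punchIn₂ (suc j) zero    c = suc (punchIn j c)
punchIn₂ {suc n} (suc j) (suc x) zero    = zero
punchIn₂ {suc n} (suc j) (suc x) (suc c) = suc (punchIn₂ j x c)

punchIn₂-comm : (j x : Fin (suc (suc n))) (c : Fin n) → punchIn₂ j x c ≡ punchIn₂ x j c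
punchIn₂-comm zero    zero    c = refl
punchIn₂-comm zero    (suc x) c = refl
punchIn₂-comm (suc j) zero    c = refl
punchIn₂-comm {suc n} (suc j) (suc x) zero    = refl
punchIn₂-comm {suc n} (suc j) (suc x) (suc c) = cong suc (punchIn₂-comm j x c)

punchIn₂-punchIn : (j : Fin (suc (suc n))) (l : Fin (suc n)) (c : Fin n) →
                   punchIn₂ j (punchIn j l) c ≡ punchIn j (punchIn l c)
punchIn₂-punchIn zero    l       c = refl
punchIn₂-punchIn (suc j) zero    c = refl
punchIn₂-punchIn {suc n} (suc j) (suc l) zero    = refl
punchIn₂-punchIn {suc n} (suc j) (suc l) (suc c) = cong suc (punchIn₂-punchIn j l c)

minor : Fin (suc m) → Fin (suc m) → Mat₂ (suc m) → Mat₂ m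
minor i j M r c = M (punchIn i r) (punchIn j c)

transpose : Mat₂ m → Mat₂ m
transpose M r c = M c r

addRow : Fin m → Fin m → Mat₂ m → Mat₂ m
addRow i k M r c = M r c xor ((r == i) ∧ M k c)

addCol : Fin m → Fin m → Mat₂ m → Mat₂ m
addCol i k M r c = M r c xor ((c == i) ∧ M r k)

foldr-xor-tabulate : (f : Fin n → Bool) → foldr _xor_ false (tabulate f) ≡ sum f
foldr-xor-tabulate {zero}  f = refl
foldr-xor-tabulate {suc n} f = cong (f zero xor_) (foldr-xor-tabulate (f ∘ suc))

det₂-expand : (M : Mat₂ (suc m)) → det₂ (suc m) M ≡ ∑[ j < suc m ] (M zero j ∧ det₂ m (minor zero j M))
det₂-expand {m} M = trans (cong (foldr _xor_ false) (map-tabulate id term)) (foldr-xor-tabulate term)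
  where
  term : Fin (suc m) → Bool
  term j = M zero j ∧ det₂ m (minor zero j M)

det₂-cong : {M N : Mat₂ m} → (∀ r c → M r c ≡ N r c) → det₂ m M ≡ det₂ m N
det₂-cong {zero}          M≗N = refl
det₂-cong {suc m} {M} {N} M≗N = begin
  det₂ (suc m) M
    ≡⟨ det₂-expand M ⟩
  ∑[ j < suc m ] (M zero j ∧ det₂ m (minor zero j M))
    ≡⟨ sum-cong-≗ (λ j → cong₂ _∧_ (M≗N zero j) (det₂-cong (λ r c → M≗N (suc r) (punchIn j c)))) ⟩
  ∑[ j < suc m ] (N zero j ∧ det₂ m (minor zero j N))
    ≡⟨ det₂-expand N ⟨
  det₂ (suc m) N
    ∎
  where open ≡-Reasoning

TransposeInvariant : ℕ → Set
TransposeInvariant m = (M : Mat₂ m) → det₂ m (transpose M) ≡ det₂ m M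

-- Expands every minor but the first along its first column, by transposing it.
det₂-expand-cross : TransposeInvariant (suc m) → TransposeInvariant m → (M : Mat₂ (suc (suc m))) →
  det₂ (suc (suc m)) M ≡
    (M zero zero ∧ det₂ (suc m) (minor zero zero M)) xor
    ∑[ j < suc m ] ∑[ i < suc m ] (M zero (suc j) ∧ (M (suc i) zero ∧ det₂ m (minor i j (minor zero zero M))))
det₂-expand-cross {m} transpose₁ transpose₀ M =
  trans (det₂-expand M) (cong ((M zero zero ∧ det₂ (suc m) (minor zero zero M)) xor_) (sum-cong-≗ expand-column))
  where
  open ≡-Reasoning
  inner : Fin (suc m) → Fin (suc m) → Bool
  inner j i = M (suc i) zero ∧ det₂ m (minor i j (minor zero zero M))
  expand-column : ∀ j → M zero (suc j) ∧ det₂ (suc m) (minor zero (suc j) M)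
                      ≡ ∑[ i < suc m ] (M zero (suc j) ∧ inner j i)
  expand-column j = begin
    M zero (suc j) ∧ det₂ (suc m) (minor zero (suc j) M)
      ≡⟨ cong (M zero (suc j) ∧_) (trans (sym (transpose₁ (minor zero (suc j) M)))
                                         (det₂-expand (transpose (minor zero (suc j) M)))) ⟩
    M zero (suc j) ∧ ∑[ i < suc m ] (M (suc i) zero ∧ det₂ m (transpose (minor i j (minor zero zero M))))
      ≡⟨ cong (M zero (suc j) ∧_)
              (sum-cong-≗ (λ i → cong (M (suc i) zero ∧_) (transpose₀ (minor i j (minor zero zero M))))) ⟩
    M zero (suc j) ∧ ∑[ i < suc m ] inner j i
      ≡⟨ *-distribˡ-sum (M zero (suc j)) (inner j) ⟩
    ∑[ i < suc m ] (M zero (suc j) ∧ inner j i)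
      ∎

det₂-transpose : ∀ m → TransposeInvariant m
det₂-transpose zero          M = refl
det₂-transpose (suc zero)    M = refl
det₂-transpose (suc (suc m)) M = begin
  det₂ (suc (suc m)) (transpose M)
    ≡⟨ det₂-expand-cross (det₂-transpose (suc m)) (det₂-transpose m) (transpose M) ⟩
  (M zero zero ∧ det₂ (suc m) (transpose M₀₀)) xor ∑[ j < suc m ] ∑[ i < suc m ] cross (transpose M) i j
    ≡⟨ cong₂ (λ d s → (M zero zero ∧ d) xor s) (det₂-transpose (suc m) M₀₀)
             (sum-cong-≗ (λ j → sum-cong-≗ (λ i → cross-transpose i j))) ⟩
  (M zero zero ∧ det₂ (suc m) M₀₀) xor ∑[ j < suc m ] ∑[ i < suc m ] cross M j i
    ≡⟨ cong ((M zero zero ∧ det₂ (suc m) M₀₀) xor_) (∑-comm (λ j i → cross M j i)) ⟩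
  (M zero zero ∧ det₂ (suc m) M₀₀) xor ∑[ i < suc m ] ∑[ j < suc m ] cross M j i
    ≡⟨ det₂-expand-cross (det₂-transpose (suc m)) (det₂-transpose m) M ⟨
  det₂ (suc (suc m)) M
    ∎
  where
  open ≡-Reasoning
  M₀₀ : Mat₂ (suc m)
  M₀₀ = minor zero zero M
  cross : Mat₂ (suc (suc m)) → Fin (suc m) → Fin (suc m) → Bool
  cross N i j = N zero (suc j) ∧ (N (suc i) zero ∧ det₂ m (minor i j (minor zero zero N)))
  cross-transpose : ∀ i j → cross (transpose M) i j ≡ cross M j i
  cross-transpose i j = trans (x∙yz≈y∙xz (M (suc j) zero) (M zero (suc i)) _)
    (cong (λ d → M zero (suc i) ∧ (M (suc j) zero ∧ d)) (det₂-transpose m (minor j i M₀₀)))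

RowExpansion : ℕ → Set
RowExpansion m = (i : Fin (suc m)) (M : Mat₂ (suc m)) →
                 det₂ (suc m) M ≡ ∑[ j < suc m ] (M i j ∧ det₂ m (minor i j M))

twoRowTerm : Fin (suc m) → Mat₂ (suc (suc m)) → Fin (suc (suc m)) → Fin (suc (suc m)) → Bool
twoRowTerm {m} i M j x = M zero j ∧ (M (suc i) x ∧ det₂ m (λ r c → M (suc (punchIn i r)) (punchIn₂ j x c)))

det₂-expand-two-rows : RowExpansion m → (i : Fin (suc m)) (M : Mat₂ (suc (suc m))) →
  det₂ (suc (suc m)) M ≡ ∑[ j < suc (suc m) ] ∑[ l < suc m ] twoRowTerm i M j (punchIn j l)
det₂-expand-two-rows {m} expand i M = trans (det₂-expand M) (sum-cong-≗ λ j → begin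
  M zero j ∧ det₂ (suc m) (minor zero j M)
    ≡⟨ cong (M zero j ∧_) (expand i (minor zero j M)) ⟩
  M zero j ∧ ∑[ l < suc m ] (M (suc i) (punchIn j l) ∧ det₂ m (minor i l (minor zero j M)))
    ≡⟨ *-distribˡ-sum (M zero j) (λ l → M (suc i) (punchIn j l) ∧ det₂ m (minor i l (minor zero j M))) ⟩
  ∑[ l < suc m ] (M zero j ∧ (M (suc i) (punchIn j l) ∧ det₂ m (minor i l (minor zero j M))))
    ≡⟨ sum-cong-≗ (λ l → cong (λ d → M zero j ∧ (M (suc i) (punchIn j l) ∧ d))
         (det₂-cong (λ r c → cong (M (suc (punchIn i r))) (sym (punchIn₂-punchIn j l c))))) ⟩
  ∑[ l < suc m ] twoRowTerm i M j (punchIn j l)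
    ∎)
  where open ≡-Reasoning

det₂-expand-row : ∀ m → RowExpansion m
det₂-expand-row m       zero    M = det₂-expand M
det₂-expand-row (suc m) (suc i) M = begin
  det₂ (suc (suc m)) M
    ≡⟨ det₂-expand-two-rows (det₂-expand-row m) i M ⟩
  ∑[ j < suc (suc m) ] ∑[ l < suc m ] twoRowTerm i M j (punchIn j l)
    ≡⟨ ∑-pairs-flip (twoRowTerm i M) ⟩
  ∑[ x < suc (suc m) ] ∑[ l < suc m ] twoRowTerm i M (punchIn x l) x
    ≡⟨ sum-cong-≗ expand-minor ⟨
  ∑[ x < suc (suc m) ] (M (suc i) x ∧ det₂ (suc m) (minor (suc i) x M))
    ∎
  where
  open ≡-Reasoning
  expand-minor : ∀ x → M (suc i) x ∧ det₂ (suc m) (minor (suc i) x M)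
                     ≡ ∑[ l < suc m ] twoRowTerm i M (punchIn x l) x
  expand-minor x = begin
    M (suc i) x ∧ det₂ (suc m) (minor (suc i) x M)
      ≡⟨ cong (M (suc i) x ∧_) (det₂-expand (minor (suc i) x M)) ⟩
    M (suc i) x ∧ ∑[ l < suc m ] (M zero (punchIn x l) ∧ det₂ m (minor zero l (minor (suc i) x M)))
      ≡⟨ *-distribˡ-sum (M (suc i) x)
                        (λ l → M zero (punchIn x l) ∧ det₂ m (minor zero l (minor (suc i) x M))) ⟩
    ∑[ l < suc m ] (M (suc i) x ∧ (M zero (punchIn x l) ∧ det₂ m (minor zero l (minor (suc i) x M))))
      ≡⟨ sum-cong-≗ (λ l → trans (x∙yz≈y∙xz (M (suc i) x) (M zero (punchIn x l)) _)
           (cong (λ d → M zero (punchIn x l) ∧ (M (suc i) x ∧ d))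
                 (det₂-cong (λ r c → cong (M (suc (punchIn i r)))
                   (trans (sym (punchIn₂-punchIn x l c)) (punchIn₂-comm x (punchIn x l) c)))))) ⟩
    ∑[ l < suc m ] twoRowTerm i M (punchIn x l) x
      ∎

det₂-expand-row-cofactors : (i : Fin (suc m)) (M N : Mat₂ (suc m)) →
                            (∀ r c → M (punchIn i r) c ≡ N (punchIn i r) c) →
                            det₂ (suc m) M ≡ ∑[ j < suc m ] (M i j ∧ det₂ m (minor i j N))
det₂-expand-row-cofactors {m} i M N M≗N-off-i =
  trans (det₂-expand-row m i M)
        (sum-cong-≗ (λ j → cong (M i j ∧_) (det₂-cong (λ r c → M≗N-off-i r (punchIn j c)))))

det₂-alternating-row₀ : (k : Fin (suc m)) (M : Mat₂ (suc (suc m))) → (∀ c → M zero c ≡ M (suc k) c) →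
                        det₂ (suc (suc m)) M ≡ false
det₂-alternating-row₀ {m} k M same =
  trans (det₂-expand-two-rows (det₂-expand-row m) k M) (∑-pairs-symmetric (twoRowTerm k M) symmetric)
  where
  open ≡-Reasoning
  D : Fin (suc (suc m)) → Fin (suc (suc m)) → Bool
  D j x = det₂ m (λ r c → M (suc (punchIn k r)) (punchIn₂ j x c))
  symmetric : ∀ j x → twoRowTerm k M j x ≡ twoRowTerm k M x j
  symmetric j x = begin
    M zero j ∧ (M (suc k) x ∧ D j x)
      ≡⟨ cong₂ (λ s d → M zero j ∧ (s ∧ d)) (sym (same x))
               (det₂-cong (λ r c → cong (M (suc (punchIn k r))) (punchIn₂-comm j x c))) ⟩
    M zero j ∧ (M zero x ∧ D x j)
      ≡⟨ x∙yz≈y∙xz (M zero j) (M zero x) (D x j) ⟩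
    M zero x ∧ (M zero j ∧ D x j)
      ≡⟨ cong (λ s → M zero x ∧ (s ∧ D x j)) (same j) ⟩
    M zero x ∧ (M (suc k) j ∧ D x j)
      ∎

det₂-alternating : {i k : Fin m} → i ≢ k → (M : Mat₂ m) → (∀ c → M i c ≡ M k c) → det₂ m M ≡ false
det₂-alternating {suc m}       {zero}  {zero}  i≢k M same = contradiction refl i≢k
det₂-alternating {suc (suc m)} {zero}  {suc k} _   M same = det₂-alternating-row₀ k M same
det₂-alternating {suc (suc m)} {suc i} {zero}  _   M same = det₂-alternating-row₀ i M (sym ∘ same)
det₂-alternating {suc m}       {suc i} {suc k} i≢k M same = begin
  det₂ (suc m) M
    ≡⟨ det₂-expand M ⟩
  ∑[ j < suc m ] (M zero j ∧ det₂ m (minor zero j M))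
    ≡⟨ sum-cong-≗ (λ j → cong (M zero j ∧_)
                               (det₂-alternating (i≢k ∘ cong suc) (minor zero j M) (same ∘ punchIn j))) ⟩
  ∑[ j < suc m ] (M zero j ∧ false)
    ≡⟨ sum-cong-≗ (λ j → ∧-zeroʳ (M zero j)) ⟩
  ∑[ j < suc m ] false
    ≡⟨ sum-replicate-zero (suc m) ⟩
  false
    ∎
  where open ≡-Reasoning

det₂-addRow : {i k : Fin m} → i ≢ k → (M : Mat₂ m) → det₂ m (addRow i k M) ≡ det₂ m M
det₂-addRow {suc m} {i} {k} i≢k M = begin
  det₂ (suc m) (addRow i k M)
    ≡⟨ det₂-expand-row-cofactors i (addRow i k M) M addRow-off-i ⟩
  ∑[ j < suc m ] ((M i j xor ((i == i) ∧ M k j)) ∧ cofactor j)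
    ≡⟨ sum-cong-≗ (λ j → cong (λ t → (M i j xor (t ∧ M k j)) ∧ cofactor j) (==-refl i)) ⟩
  ∑[ j < suc m ] ((M i j xor M k j) ∧ cofactor j)
    ≡⟨ sum-cong-≗ (λ j → ∧-distribʳ-xor (cofactor j) (M i j) (M k j)) ⟩
  ∑[ j < suc m ] ((M i j ∧ cofactor j) xor (M k j ∧ cofactor j))
    ≡⟨ ∑-distrib-+ (λ j → M i j ∧ cofactor j) (λ j → M k j ∧ cofactor j) ⟩
  ∑[ j < suc m ] (M i j ∧ cofactor j) xor ∑[ j < suc m ] (M k j ∧ cofactor j)
    ≡⟨ cong₂ _xor_ (det₂-expand-row m i M) N-expand ⟨
  det₂ (suc m) M xor det₂ (suc m) N
    ≡⟨ cong (det₂ (suc m) M xor_) (det₂-alternating i≢k N (λ c → trans (N-row-i c) (sym (N-row-k c)))) ⟩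
  det₂ (suc m) M xor false
    ≡⟨ xor-identityʳ _ ⟩
  det₂ (suc m) M
    ∎
  where
  open ≡-Reasoning
  cofactor : Fin (suc m) → Bool
  cofactor j = det₂ m (minor i j M)
  addRow-off-i : ∀ r c → addRow i k M (punchIn i r) c ≡ M (punchIn i r) c
  addRow-off-i r c =
    trans (cong (λ t → M (punchIn i r) c xor (t ∧ M k c)) (==-≢ (punchInᵢ≢i i r))) (xor-identityʳ _)
  N : Mat₂ (suc m)
  N = updateAt M i (λ _ → M k)
  N-row-i : ∀ c → N i c ≡ M k c
  N-row-i = cong-app (updateAt-updates i M)
  N-row-k : ∀ c → N k c ≡ M k c
  N-row-k = cong-app (updateAt-minimal k i M (i≢k ∘ sym))
  N-expand : det₂ (suc m) N ≡ ∑[ j < suc m ] (M k j ∧ cofactor j)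
  N-expand =
    trans (det₂-expand-row-cofactors i N M (λ r → cong-app (updateAt-minimal (punchIn i r) i M (punchInᵢ≢i i r))))
          (sum-cong-≗ (λ j → cong (_∧ cofactor j) (N-row-i j)))

det₂-addCol : {i k : Fin m} → i ≢ k → (M : Mat₂ m) → det₂ m (addCol i k M) ≡ det₂ m M
det₂-addCol {m} {i} {k} i≢k M = begin
  det₂ m (transpose (addRow i k (transpose M)))  ≡⟨ det₂-transpose m (addRow i k (transpose M)) ⟩
  det₂ m (addRow i k (transpose M))              ≡⟨ det₂-addRow i≢k (transpose M) ⟩
  det₂ m (transpose M)                           ≡⟨ det₂-transpose m M ⟩
  det₂ m M                                       ∎
  where open ≡-Reasoning

reindex : (Fin m → Fin n) → Adj n → Mat₂ m
reindex f A p q = A (f p) (f q)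

reindex-congruence : {f : Fin m → Fin n} → Injective _≡_ _≡_ f → ∀ i k (A : Adj n) p q →
  reindex f (addCol (f i) (f k) (addRow (f i) (f k) A)) p q ≡ addCol i k (addRow i k (reindex f A)) p q
reindex-congruence {f = f} inj i k A p q =
  cong₂ (λ s t → (A (f p) (f q) xor (s ∧ A (f k) (f q))) xor (t ∧ (A (f p) (f k) xor (s ∧ A (f k) (f k)))))
        (==-injective inj p i) (==-injective inj q i)

switchNbhd≗congruence : (G : SimpleGraph n) (a b : Fin n) →
  ∀ x y → switchNbhd a b (adj G) x y ≡ addCol a b (addRow a b (adj G)) x y
switchNbhd≗congruence G a b x y with x ≟ a | y ≟ a
... | yes refl | yes refl = sym (begin
  (A a a xor A b a) xor (A a b xor A b b)
    ≡⟨ cong₂ (λ s t → (A a a xor A b a) xor (s xor t)) (SimpleGraph.sym G a b) (irrefl G b) ⟩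
  (A a a xor A b a) xor (A b a xor false)
    ≡⟨ cong ((A a a xor A b a) xor_) (xor-identityʳ (A b a)) ⟩
  (A a a xor A b a) xor A b a
    ≡⟨ xor-assoc (A a a) (A b a) (A b a) ⟩
  A a a xor (A b a xor A b a)
    ≡⟨ cong (A a a xor_) (xor-same (A b a)) ⟩
  A a a xor false
    ∎)
  where
  open ≡-Reasoning
  A = adj G
... | yes refl | no _     = trans (cong (adj G a y xor_) (∨-identityʳ (adj G b y))) (sym (xor-identityʳ _))
... | no _     | yes refl =
  sym (cong₂ _xor_ (xor-identityʳ (adj G x a)) (trans (xor-identityʳ (adj G x b)) (SimpleGraph.sym G x b)))
... | no _     | no _     = sym (xor-identityʳ _)

det₂-reindex-switchNbhd : (G : SimpleGraph n) {f : Fin m → Fin n} → Injective _≡_ _≡_ f →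
                          {i k : Fin m} → i ≢ k →
                          det₂ m (reindex f (switchNbhd (f i) (f k) (adj G))) ≡ det₂ m (reindex f (adj G))
det₂-reindex-switchNbhd {m = m} G {f} inj {i} {k} i≢k = begin
  det₂ m (reindex f (switchNbhd (f i) (f k) (adj G)))
    ≡⟨ det₂-cong (λ p q → switchNbhd≗congruence G (f i) (f k) (f p) (f q)) ⟩
  det₂ m (reindex f (addCol (f i) (f k) (addRow (f i) (f k) (adj G))))
    ≡⟨ det₂-cong (reindex-congruence inj i k (adj G)) ⟩
  det₂ m (addCol i k (addRow i k (reindex f (adj G))))
    ≡⟨ det₂-addCol i≢k (addRow i k (reindex f (adj G))) ⟩
  det₂ m (addRow i k (reindex f (adj G)))
    ≡⟨ det₂-addRow i≢k (reindex f (adj G)) ⟩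
  det₂ m (reindex f (adj G))
    ∎
  where open ≡-Reasoning

unique-lookup-injective : {A : Set} {xs : List A} → Unique xs → Injective _≡_ _≡_ (lookup xs)
unique-lookup-injective {xs = _ ∷ _} _            {zero}  {zero}  _   = refl
unique-lookup-injective {xs = _ ∷ _} (x≢xs ∷ _)   {zero}  {suc j} x≡y =
  contradiction x≡y (All.lookup x≢xs (∈-lookup j))
unique-lookup-injective {xs = _ ∷ _} (x≢xs ∷ _)   {suc i} {zero}  y≡x =
  contradiction (sym y≡x) (All.lookup x≢xs (∈-lookup i))
unique-lookup-injective {xs = _ ∷ _} (_ ∷ unique) {suc i} {suc j} eq  =
  cong suc (unique-lookup-injective unique eq)

members-unique : (U : Subset n) → Unique (members U)
members-unique []          = []
members-unique (true  ∷ U) =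
  All.map⁺ (All.universal (λ _ ()) (members U)) ∷ map⁺ suc-injective (members-unique U)
members-unique (false ∷ U) = map⁺ suc-injective (members-unique U)

∈-members : {x : Fin n} {U : Subset n} → x ∈ U → x ∈ₗ members U
∈-members here                        = here refl
∈-members {U = true  ∷ U} (there x∈U) = there (∈-map⁺ suc (∈-members x∈U))
∈-members {U = false ∷ U} (there x∈U) = ∈-map⁺ suc (∈-members x∈U)

members-∈ : {x : Fin n} {U : Subset n} → x ∈ₗ members U → x ∈ U
members-∈ {U = true ∷ U} (here refl) = here
members-∈ {U = true ∷ U} (there x∈) with ∈-map⁻ suc x∈
... | _ , y∈ , refl = there (members-∈ y∈)
members-∈ {U = false ∷ U} x∈ with ∈-map⁻ suc x∈
... | _ , y∈ , refl = there (members-∈ y∈)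

members-position : {x : Fin n} {U : Subset n} → x ∈ U → ∃[ p ] lookup (members U) p ≡ x
members-position x∈U = index (∈-members x∈U) , sym (lookup-index (∈-members x∈U))

members-≢ : {x : Fin n} {U : Subset n} → x ∉ U → ∀ p → lookup (members U) p ≢ x
members-≢ x∉U p refl = x∉U (members-∈ (∈-lookup p))

ν-switchNbhd : (G : SimpleGraph n) {a b : Fin n} {U : Subset n} → a ≢ b → a ∈ U → b ∈ U →
               ν (switchNbhd a b (adj G)) U ≡ ν (adj G) U
ν-switchNbhd G {U = U} a≢b a∈U b∈U
  with i , refl ← members-position a∈U | k , refl ← members-position b∈U
  = det₂-reindex-switchNbhd G (unique-lookup-injective (members-unique U)) (a≢b ∘ cong (lookup (members U)))

switchEdge-apart : (A : Adj n) {a b x y : Fin n} → (x ≢ a × y ≢ a) ⊎ (x ≢ b × y ≢ b) →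
                   switchEdge a b A x y ≡ A x y
switchEdge-apart A {a} {b} {x} {y} (inj₁ (x≢a , y≢a)) rewrite ==-≢ x≢a | ==-≢ y≢a =
  trans (cong (A x y xor_) (∧-zeroʳ (x == b))) (xor-identityʳ _)
switchEdge-apart A {a} {b} {x} {y} (inj₂ (x≢b , y≢b)) rewrite ==-≢ x≢b | ==-≢ y≢b =
  trans (cong (λ t → A x y xor (t ∨ false)) (∧-zeroʳ (x == a))) (xor-identityʳ _)

ν-switchEdge : (A : Adj n) {a b : Fin n} {U : Subset n} → a ∉ U ⊎ b ∉ U → ν (switchEdge a b A) U ≡ ν A U
ν-switchEdge A (inj₁ a∉U) =
  det₂-cong (λ p q → switchEdge-apart A (inj₁ (members-≢ a∉U p , members-≢ a∉U q)))
ν-switchEdge A (inj₂ b∉U) =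
  det₂-cong (λ p q → switchEdge-apart A (inj₂ (members-≢ b∉U p , members-≢ b∉U q)))

switchEdgeGraph : (G : SimpleGraph n) {a b : Fin n} → a ≢ b → SimpleGraph n
switchEdgeGraph G {a} {b} a≢b = record
  { adj    = switchEdge a b (adj G)
  ; sym    = λ x y → cong₂ _xor_ (SimpleGraph.sym G x y)
                       (trans (∨-comm ((x == a) ∧ (y == b)) ((x == b) ∧ (y == a)))
                              (cong₂ _∨_ (∧-comm (x == b) (y == a)) (∧-comm (x == a) (y == b))))
  ; irrefl = λ x → trans (switchEdge-apart (adj G) (apart x)) (irrefl G x)
  }
  where
  apart : ∀ x → (x ≢ a × x ≢ a) ⊎ (x ≢ b × x ≢ b)
  apart x with x ≟ a
  ... | yes refl = inj₂ (a≢b , a≢b)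
  ... | no x≢a   = inj₁ (x≢a , x≢a)

-- In row b, switching the edge ab only changes column a, which switchNbhd a b never reads.
switchEdge-switchNbhd-comm : (A : Adj n) {a b : Fin n} → a ≢ b →
  ∀ x y → switchEdge a b (switchNbhd a b A) x y ≡ switchNbhd a b (switchEdge a b A) x y
switchEdge-switchNbhd-comm A {a} {b} a≢b x y rewrite ==-≢ (a≢b ∘ sym) | ==-refl b =
  trans (xy∙z≈xz∙y (A x y) _ _)
        (cong ((A x y xor _) xor_) (cong₂ _∨_ (cong ((x == a) ∧_) (sym (unread (y == a) (A b y))))
                                              (cong ((y == a) ∧_) (sym (unread (x == a) (A b x))))))
  where
  unread : ∀ p q → not p ∧ (q xor p) ≡ not p ∧ q
  unread false q = xor-identityʳ q
  unread true  q = refl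

-- For Booleans this says exactly that f x - g x ≡ h x - l x as integers.
SameDifference : {X : Set} → (f g h l : X → Bool) → Set
SameDifference f g h l = ∀ x → (f x ≡ g x × h x ≡ l x) ⊎ (f x ≡ h x × g x ≡ l x)

ν-switch-sameDifference : (G : SimpleGraph n) {a b : Fin n} → a ≢ b →
  let A = adj G ; B = switchNbhd a b A in SameDifference (ν A) (ν (switchEdge a b A)) (ν B) (ν (switchEdge a b B))
ν-switch-sameDifference G {a} {b} a≢b U with a ∈? U | b ∈? U
... | yes a∈U | yes b∈U = inj₂ (sym (ν-switchNbhd G a≢b a∈U b∈U) , sym (begin
  ν (switchEdge a b (switchNbhd a b (adj G))) U
    ≡⟨ det₂-cong (λ p q → switchEdge-switchNbhd-comm (adj G) a≢b (x p) (x q)) ⟩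
  ν (switchNbhd a b (switchEdge a b (adj G))) U
    ≡⟨ ν-switchNbhd (switchEdgeGraph G a≢b) a≢b a∈U b∈U ⟩
  ν (switchEdge a b (adj G)) U
    ∎))
  where
  open ≡-Reasoning
  x = lookup (members U)
... | no a∉U | _      =
  inj₁ (sym (ν-switchEdge (adj G) (inj₁ a∉U)) , sym (ν-switchEdge (switchNbhd a b (adj G)) (inj₁ a∉U)))
... | _      | no b∉U =
  inj₁ (sym (ν-switchEdge (adj G) (inj₂ b∉U)) , sym (ν-switchEdge (switchNbhd a b (adj G)) (inj₂ b∉U)))

count : {X : Set} → (X → Bool) → List X → ℕ
count f xs = length (filter (λ x → f x Data.Bool.≟ true) xs)

count-∷ : {X : Set} (f : X → Bool) (x : X) (xs : List X) →
          count f (x ∷ xs) ≡ (if f x then 1 else 0) + count f xs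
count-∷ f x xs with f x
... | true  = refl
... | false = refl

count-sameDifference : {X : Set} {f g h l : X → Bool} → SameDifference f g h l →
                       ∀ xs → count f xs + count l xs ≡ count g xs + count h xs
count-sameDifference same []                             = refl
count-sameDifference {f = f} {g} {h} {l} same (x ∷ xs) = begin
  count f (x ∷ xs) + count l (x ∷ xs)
    ≡⟨ cong₂ _+_ (count-∷ f x xs) (count-∷ l x xs) ⟩
  ([ f x ] + count f xs) + ([ l x ] + count l xs)
    ≡⟨ interchange [ f x ] (count f xs) [ l x ] (count l xs) ⟩
  ([ f x ] + [ l x ]) + (count f xs + count l xs)
    ≡⟨ cong₂ _+_ (indicators (same x)) (count-sameDifference same xs) ⟩
  ([ g x ] + [ h x ]) + (count g xs + count h xs)
    ≡⟨ interchange [ g x ] [ h x ] (count g xs) (count h xs) ⟩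
  ([ g x ] + count g xs) + ([ h x ] + count h xs)
    ≡⟨ cong₂ _+_ (count-∷ g x xs) (count-∷ h x xs) ⟨
  count g (x ∷ xs) + count h (x ∷ xs)
    ∎
  where
  open ≡-Reasoning
  [_] : Bool → ℕ
  [ b ] = if b then 1 else 0
  indicators : (f x ≡ g x × h x ≡ l x) ⊎ (f x ≡ h x × g x ≡ l x) → [ f x ] + [ l x ] ≡ [ g x ] + [ h x ]
  indicators (inj₁ (f≡g , h≡l)) rewrite f≡g | h≡l = refl
  indicators (inj₂ (f≡h , g≡l)) rewrite f≡h | g≡l = +-comm [ h x ] [ l x ]

[+p]-[+q]≡[+r]-[+s] : {p q r s : ℕ} → p + s ≡ q + r → + p - + q ≡ + r - + s
[+p]-[+q]≡[+r]-[+s] {p} {q} {r} {s} p+s≡q+r = begin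
  + p - + q          ≡⟨ [+m]-[+n]≡m⊖n p q ⟩
  p ⊖ q              ≡⟨ +-cancelˡ-⊖ s p q ⟨
  (s + p) ⊖ (s + q)  ≡⟨ cong₂ _⊖_ (trans (+-comm s p) p+s≡q+r) (+-comm s q) ⟩
  (q + r) ⊖ (q + s)  ≡⟨ +-cancelˡ-⊖ q r s ⟩
  r ⊖ s              ≡⟨ [+m]-[+n]≡m⊖n r s ⟨
  + r - + s          ∎
  where open ≡-Reasoning

Qcoeff-sameDifference : {A A′ B B′ : Adj n} → SameDifference (ν A) (ν A′) (ν B) (ν B′) →
                        ∀ k → Qcoeff A k - Qcoeff A′ k ≡ Qcoeff B k - Qcoeff B′ k
Qcoeff-sameDifference {n} {A} {A′} {B} {B′} same k =
  [+p]-[+q]≡[+r]-[+s] {coeff A} {coeff A′} {coeff B} {coeff B′} (count-sameDifference restricted (allSubsets n))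
  where
  right-size : Subset n → Bool
  right-size U = ⌊ n ∸ ∣ U ∣ Data.Nat.≟ k ⌋
  term : Adj n → Subset n → Bool
  term C U = ν C U ∧ right-size U
  coeff : Adj n → ℕ
  coeff C = count (term C) (allSubsets n)
  restricted : SameDifference (term A) (term A′) (term B) (term B′)
  restricted U = Sum.map (Product.map restrict restrict) (Product.map restrict restrict) (same U)
    where
    restrict : ∀ {s t} → s ≡ t → s ∧ right-size U ≡ t ∧ right-size U
    restrict = cong (_∧ right-size U)

mainTheorem2 : (n : ℕ) (G : SimpleGraph n) (a b : Fin n) → ¬ (a ≡ b) → (k : ℕ) →
    Qcoeff (adj G) k - Qcoeff (switchEdge a b (adj G)) k
      ≡ Qcoeff (switchNbhd a b (adj G)) k - Qcoeff (switchEdge a b (switchNbhd a b (adj G))) k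
mainTheorem2 n G a b a≢b =
  Qcoeff-sameDifference {A = A} {switchEdge a b A} {B} {switchEdge a b B} (ν-switch-sameDifference G a≢b)
  where
  A = adj G
  B = switchNbhd a b A
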